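{- Let $b_{2i}=1$, $b_{2i+1}=0$ for $i\ge0$ and $\lambda_k=\lfloor (k+1)/2\rfloor\,t$ for $k\ge1$. Then for every $n\ge0$, $$D_{n+1}(1,-1,t)=\sum_{p}w(p),$$ the sum over all André paths $p$ of length $n$.
   Context: For $n\in\mathbb{N}$, $[n]_{p,q}=\sum_{i+j=n-1}p^iq^j$ and $\binom{n}{k}_{p,q}=\frac{[n]_{p,q}\cdots[n-k+1]_{p,q}}{[1]_{p,q}\cdots[k]_{p,q}}$. The polynomials $D_n(p,q,t)$ ($n\ge1$) are defined by $$\sum_{n\ge0}D_{n+1}(p,q,t)x^n=\cfrac{1}{1-[1]_{p,q}x-\cfrac{\binom{2}{2}_{p,q}t\,x^2}{1-[2]_{p,q}x-\cfrac{\binom{3}{2}_{p,q}t\,x^2}{1-[3]_{p,q}x-\cdots}}}$$ (level $m$: $b_m=[m+1]_{p,q}$, $\lambda_m=\binom{m+1}{2}_{p,q}t$), as formal power series in $x$. A Motzkin path of length $n$ is a lattice path from $(0,0)$ to $(n,0)$ never going below the $x$-axis, with steps $\mathsf{U}=(1,1)$, $\mathsf{L}=(1,0)$, $\mathsf{D}=(1,-1)$; the height of a step is the $y$-coordinate of its starting point. An André path is a Motzkin path with no level step at odd height. Each up step has weight $1$, a level step at height $i$ has weight $b_i$, a down step at height $i$ has weight $\lambda_i$, and $w(p)$ is the product of the step weights. -}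

module Defs where

open import Level using (Level)
open import Data.Nat using (ℕ; zero; suc; _∸_; _/_)
open import Data.Bool using (Bool; true; false; _∧_; if_then_else_)
open import Data.List using (List; []; _∷_; map; concatMap)
open import Algebra.Bundles using (CommutativeRing)

-- Steps of a lattice path: U = (1,1), L = (1,0), D = (1,-1).
data Step : Set where
  U L D : Step

words : ℕ → List (List Step)
words zero    = [] ∷ []
words (suc n) = concatMap (λ w → (U ∷ w) ∷ (L ∷ w) ∷ (D ∷ w) ∷ []) (words n)

isEven : ℕ → Bool
isEven zero          = true
isEven (suc zero)    = false
isEven (suc (suc k)) = isEven k

isZero : ℕ → Bool
isZero zero    = true
isZero (suc _) = false

motzkinFrom : ℕ → List Step → Bool
motzkinFrom h []             = isZero h
motzkinFrom h (U ∷ s)        = motzkinFrom (suc h) s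
motzkinFrom h (L ∷ s)        = motzkinFrom h s
motzkinFrom zero (D ∷ s)     = false
motzkinFrom (suc h) (D ∷ s)  = motzkinFrom h s

isMotzkin : List Step → Bool
isMotzkin = motzkinFrom 0

noOddLevelFrom : ℕ → List Step → Bool
noOddLevelFrom h []             = true
noOddLevelFrom h (U ∷ s)        = noOddLevelFrom (suc h) s
noOddLevelFrom h (L ∷ s)        = isEven h ∧ noOddLevelFrom h s
noOddLevelFrom zero (D ∷ s)     = noOddLevelFrom zero s
noOddLevelFrom (suc h) (D ∷ s)  = noOddLevelFrom h s

isAndre : List Step → Bool
isAndre s = isMotzkin s ∧ noOddLevelFrom 0 s

module _ {c ℓ : Level} (R : CommutativeRing c ℓ) where
  open CommutativeRing R using (Carrier; _+_; _*_; 0#; 1#)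

  sumUpTo : ℕ → (ℕ → Carrier) → Carrier
  sumUpTo zero    f = f zero
  sumUpTo (suc k) f = sumUpTo k f + f (suc k)

  sumList : List Carrier → Carrier
  sumList []       = 0#
  sumList (x ∷ xs) = x + sumList xs

  pow : Carrier → ℕ → Carrier
  pow x zero    = 1#
  pow x (suc k) = x * pow x k

  natTimes : ℕ → Carrier → Carrier
  natTimes zero    x = 0#
  natTimes (suc k) x = x + natTimes k x

  -- [n]_{p,q} = Σ_{i+j=n-1} p^i q^j   ([0]_{p,q} = 0, empty sum)
  pqInt : Carrier → Carrier → ℕ → Carrier
  pqInt p q zero    = 0#
  pqInt p q (suc n) = sumUpTo n (λ i → pow p i * pow q (n ∸ i))

  -- (p,q)-binomial coefficient, as a polynomial in p,q, via the (p,q)-Pascal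
  -- recurrence  C(n+1,k+1) = p^(n-k) C(n,k) + q^(k+1) C(n,k+1).
  pqBinom : Carrier → Carrier → ℕ → ℕ → Carrier
  pqBinom p q n       zero    = 1#
  pqBinom p q zero    (suc k) = 0#
  pqBinom p q (suc n) (suc k) =
    pow p (n ∸ k) * pqBinom p q n k + pow q (suc k) * pqBinom p q n (suc k)

  -- Coefficients of the J-fraction  F_m = 1/(1 - b_m x - λ_{m+1} x² F_{m+1})
  -- as formal power series: F_m is the unique series with
  --   F_m = 1 + b_m x F_m + λ_{m+1} x² F_{m+1} F_m,
  -- i.e.  [x^0]F_m = 1, [x^1]F_m = b_m,
  --   [x^{k+2}]F_m = b_m [x^{k+1}]F_m + λ_{m+1} Σ_{i+j=k} [x^i]F_{m+1} [x^j]F_m.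
  -- jcoef fuel m k = [x^k] F_m whenever k ≤ fuel.
  jcoef : (ℕ → Carrier) → (ℕ → Carrier) → ℕ → ℕ → ℕ → Carrier
  jcoef b lam fuel       m zero          = 1#
  jcoef b lam zero       m (suc k)       = 0#
  jcoef b lam (suc f)    m (suc zero)    = b m * jcoef b lam f m zero
  jcoef b lam (suc f)    m (suc (suc k)) =
    b m * jcoef b lam f m (suc k)
    + lam (suc m) * sumUpTo k (λ i → jcoef b lam f (suc m) i * jcoef b lam f m (k ∸ i))

  jfracCoef : (ℕ → Carrier) → (ℕ → Carrier) → ℕ → Carrier
  jfracCoef b lam n = jcoef b lam n zero n

  -- D_{n}(p,q,t) for n ≥ 1:  Σ_{n≥0} D_{n+1} x^n is the J-fraction with
  -- b_m = [m+1]_{p,q}, λ_m = C(m+1,2)_{p,q} t.  (D_0 is not defined in the paper; set to 0.)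
  Dpoly : Carrier → Carrier → Carrier → ℕ → Carrier
  Dpoly p q t zero    = 0#
  Dpoly p q t (suc n) =
    jfracCoef (λ m → pqInt p q (suc m)) (λ m → pqBinom p q (suc m) 2 * t) n

  -- weight of a path starting at height h: U ↦ 1, L at height i ↦ b i,
  -- D at height i ↦ λ i  (height = y-coordinate of the starting point).
  weightFrom : (ℕ → Carrier) → (ℕ → Carrier) → ℕ → List Step → Carrier
  weightFrom b lam h []            = 1#
  weightFrom b lam h (U ∷ s)       = 1# * weightFrom b lam (suc h) s
  weightFrom b lam h (L ∷ s)       = b h * weightFrom b lam h s
  weightFrom b lam zero (D ∷ s)    = lam zero * weightFrom b lam zero s
  weightFrom b lam (suc h) (D ∷ s) = lam (suc h) * weightFrom b lam h s

  weight : (ℕ → Carrier) → (ℕ → Carrier) → List Step → Carrier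
  weight b lam = weightFrom b lam 0

  andreSum : (ℕ → Carrier) → (ℕ → Carrier) → ℕ → Carrier
  andreSum b lam n =
    sumList (map (λ s → if isAndre s then weight b lam s else 0#) (words n))

  bAndre : ℕ → Carrier
  bAndre m = if isEven m then 1# else 0#

  lamAndre : Carrier → ℕ → Carrier
  lamAndre t k = natTimes (suc k / 2) t

-- A J-fraction expands into weighted Motzkin paths (Flajolet): the recursion defining the
-- coefficients of F_m = 1/(1 - b_m x - λ_{m+1} x² F_{m+1}) is the decomposition of a path
-- from height 0 by its first step, where an up step is matched with the first descent back
-- to height 0.  At p = 1, q = -1 the weights become [m+1]_{1,-1} = 1, 0, 1, 0, … and
-- C(m+1,2)_{1,-1} = ⌊(m+1)/2⌋, and since b vanishes at odd heights the Motzkin paths of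
-- nonzero weight are exactly the André paths.
module Submission where

open import Defs
open import Data.Nat using (ℕ; zero; suc; _≤_; _∸_; _/_; s≤s; z≤n)
open import Data.Nat.Properties using (≤-refl; ≤-trans; m≤n⇒m≤1+n; n≤1+n; m∸n≤m)
open import Data.Nat.DivMod using (m/n≡1+[m∸n]/n)
open import Data.Bool using (true; false; _∧_; if_then_else_)
open import Data.List using (List; []; _∷_; map; concatMap)
open import Function using (_∘_)
open import Algebra.Bundles using (CommutativeRing)
open import Relation.Binary.PropositionalEquality as ≡ using (_≡_)
import Algebra.Properties.Ring as RingProperties
import Algebra.Properties.CommutativeSemigroup as CommutativeSemigroupProperties
import Algebra.Solver.Ring.NaturalCoefficients.Default as NaturalCoefficientsSolver
import Relation.Binary.Reasoning.Setoid as SetoidReasoning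

module _ {c ℓ} (R : CommutativeRing c ℓ) where
  open CommutativeRing R hiding (zero)
  open RingProperties ring using (-1*x≈-x; -‿involutive)
  open CommutativeSemigroupProperties +-commutativeSemigroup using (interchange)
  open NaturalCoefficientsSolver commutativeSemiring using (solve; _:+_; _:*_; _:=_)
  open SetoidReasoning setoid

  sum-cong : ∀ k {f g : ℕ → Carrier} → (∀ i → i ≤ k → f i ≈ g i) → sumUpTo R k f ≈ sumUpTo R k g
  sum-cong zero    f≈g = f≈g 0 z≤n
  sum-cong (suc k) f≈g = +-cong (sum-cong k (λ i i≤k → f≈g i (m≤n⇒m≤1+n i≤k))) (f≈g (suc k) ≤-refl)

  sum-suc : ∀ k (f : ℕ → Carrier) → sumUpTo R (suc k) f ≈ f 0 + sumUpTo R k (f ∘ suc)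
  sum-suc zero    f = refl
  sum-suc (suc k) f = trans (+-cong (sum-suc k f) refl) (+-assoc _ _ _)

  sum-+ : ∀ k (f g : ℕ → Carrier) → sumUpTo R k (λ i → f i + g i) ≈ sumUpTo R k f + sumUpTo R k g
  sum-+ zero    f g = refl
  sum-+ (suc k) f g = trans (+-cong (sum-+ k f g) refl) (interchange _ _ _ _)

  sum-* : ∀ k a (f : ℕ → Carrier) → sumUpTo R k (λ i → a * f i) ≈ a * sumUpTo R k f
  sum-* zero    a f = refl
  sum-* (suc k) a f = trans (+-cong (sum-* k a f) refl) (sym (distribˡ a _ _))

  infixl 7 _⊛_
  _⊛_ : (ℕ → Carrier) → (ℕ → Carrier) → ℕ → Carrier
  (f ⊛ g) n = sumUpTo R n (λ i → f i * g (n ∸ i))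

  ⊛-cong : ∀ n {f f′ g g′ : ℕ → Carrier} →
    (∀ i → i ≤ n → f i ≈ f′ i) → (∀ i → i ≤ n → g i ≈ g′ i) → (f ⊛ g) n ≈ (f′ ⊛ g′) n
  ⊛-cong n f≈f′ g≈g′ = sum-cong n (λ i i≤n → *-cong (f≈f′ i i≤n) (g≈g′ (n ∸ i) (m∸n≤m n i)))

  ⊛-suc : ∀ n (f g : ℕ → Carrier) → (f ⊛ g) (suc n) ≈ f 0 * g (suc n) + ((f ∘ suc) ⊛ g) n
  ⊛-suc n f g = sum-suc n (λ i → f i * g (suc n ∸ i))

  ⊛-linearˡ : ∀ n a (f g h : ℕ → Carrier) →
    ((λ i → f i + a * g i) ⊛ h) n ≈ (f ⊛ h) n + a * (g ⊛ h) n
  ⊛-linearˡ n a f g h = begin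
      ((λ i → f i + a * g i) ⊛ h) n
    ≈⟨ sum-cong n (λ i _ → trans (distribʳ _ _ _) (+-cong refl (*-assoc _ _ _))) ⟩
      sumUpTo R n (λ i → f i * h (n ∸ i) + a * (g i * h (n ∸ i)))
    ≈⟨ trans (sum-+ n _ _) (+-cong refl (sum-* n a _)) ⟩
      (f ⊛ h) n + a * (g ⊛ h) n ∎

  -- motzkinWeight b l h n is the total weight of the paths of length n from height h to
  -- height 0 that never go below the axis.
  module _ (b l : ℕ → Carrier) where
    motzkinWeight : ℕ → ℕ → Carrier
    motzkinWeight zero    zero    = 1#
    motzkinWeight (suc h) zero    = 0#
    motzkinWeight zero    (suc n) = motzkinWeight 1 n + b 0 * motzkinWeight 0 n
    motzkinWeight (suc h) (suc n) =
      motzkinWeight (suc (suc h)) n + b (suc h) * motzkinWeight (suc h) n + l (suc h) * motzkinWeight h n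

  motzkinWeight-cong : ∀ {b b′ l l′} → (∀ i → b i ≈ b′ i) → (∀ i → l i ≈ l′ i) →
    ∀ h n → motzkinWeight b l h n ≈ motzkinWeight b′ l′ h n
  motzkinWeight-cong b≈b′ l≈l′ zero    zero    = refl
  motzkinWeight-cong b≈b′ l≈l′ (suc h) zero    = refl
  motzkinWeight-cong b≈b′ l≈l′ zero    (suc n) =
    +-cong (motzkinWeight-cong b≈b′ l≈l′ 1 n) (*-cong (b≈b′ 0) (motzkinWeight-cong b≈b′ l≈l′ 0 n))
  motzkinWeight-cong b≈b′ l≈l′ (suc h) (suc n) =
    +-cong (+-cong (motzkinWeight-cong b≈b′ l≈l′ (suc (suc h)) n)
                   (*-cong (b≈b′ (suc h)) (motzkinWeight-cong b≈b′ l≈l′ (suc h) n)))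
           (*-cong (l≈l′ (suc h)) (motzkinWeight-cong b≈b′ l≈l′ h n))

  0+x*0+y≈y : ∀ x y → 0# + x * 0# + y ≈ y
  0+x*0+y≈y x y = trans (+-cong (trans (+-identityˡ _) (zeroʳ x)) refl) (+-identityˡ y)

  -- A path from height d+1 first reaches height 0 by a down step from height 1; before that
  -- step it is a path from d to 0 with heights (and hence weights) shifted by one.
  motzkinWeight-descent : ∀ b l n d → motzkinWeight b l (suc d) (suc n)
    ≈ l 1 * (motzkinWeight (b ∘ suc) (l ∘ suc) d ⊛ motzkinWeight b l 0) n
  motzkinWeight-descent b l zero zero =
    trans (0+x*0+y≈y (b 1) _) (*-cong refl (sym (*-identityˡ 1#)))
  motzkinWeight-descent b l zero (suc d) =
    trans (0+x*0+y≈y (b (suc (suc d))) _) (trans (zeroʳ _) (sym (trans (*-cong refl (zeroˡ 1#)) (zeroʳ _))))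
  motzkinWeight-descent b l (suc n) zero = begin
      M 2 (suc n) + b 1 * M 1 (suc n) + l 1 * Z (suc n)
    ≈⟨ +-cong (+-cong (motzkinWeight-descent b l n 1) (*-cong refl (motzkinWeight-descent b l n 0))) refl ⟩
      l 1 * (M′ 1 ⊛ Z) n + b 1 * (l 1 * (M′ 0 ⊛ Z) n) + l 1 * Z (suc n)
    ≈⟨ regroup (l 1) _ _ _ _ ⟨
      l 1 * (Z (suc n) + ((M′ 1 ⊛ Z) n + b 1 * (M′ 0 ⊛ Z) n))
    ≈⟨ *-cong refl (+-cong (*-identityˡ _) (⊛-linearˡ n (b 1) (M′ 1) (M′ 0) Z)) ⟨
      l 1 * (1# * Z (suc n) + ((M′ 0 ∘ suc) ⊛ Z) n)
    ≈⟨ *-cong refl (⊛-suc n (M′ 0) Z) ⟨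
      l 1 * (M′ 0 ⊛ Z) (suc n) ∎
    where
    M = motzkinWeight b l
    M′ = motzkinWeight (b ∘ suc) (l ∘ suc)
    Z = M 0
    regroup : ∀ l z x b y → l * (z + (x + b * y)) ≈ l * x + b * (l * y) + l * z
    regroup = solve 5 (λ l z x b y →
      l :* (z :+ (x :+ b :* y)) := l :* x :+ b :* (l :* y) :+ l :* z) refl
  motzkinWeight-descent b l (suc n) (suc d) = begin
      M (suc d₂) (suc n) + b d₂ * M d₂ (suc n) + l d₂ * M (suc d) (suc n)
    ≈⟨ +-cong (+-cong (motzkinWeight-descent b l n d₂) (*-cong refl (motzkinWeight-descent b l n (suc d))))
              (*-cong refl (motzkinWeight-descent b l n d)) ⟩
      l 1 * (M′ d₂ ⊛ Z) n + b d₂ * (l 1 * (M′ (suc d) ⊛ Z) n) + l d₂ * (l 1 * (M′ d ⊛ Z) n)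
    ≈⟨ regroup (l 1) _ _ _ _ _ ⟨
      l 1 * ((M′ d₂ ⊛ Z) n + b d₂ * (M′ (suc d) ⊛ Z) n + l d₂ * (M′ d ⊛ Z) n)
    ≈⟨ *-cong refl (trans (⊛-linearˡ n (l d₂) _ (M′ d) Z)
                          (+-cong (⊛-linearˡ n (b d₂) _ _ Z) refl)) ⟨
      l 1 * ((M′ (suc d) ∘ suc) ⊛ Z) n
    ≈⟨ *-cong refl (trans (+-cong (zeroˡ _) refl) (+-identityˡ _)) ⟨
      l 1 * (0# * Z (suc n) + ((M′ (suc d) ∘ suc) ⊛ Z) n)
    ≈⟨ *-cong refl (⊛-suc n (M′ (suc d)) Z) ⟨
      l 1 * (M′ (suc d) ⊛ Z) (suc n) ∎
    where
    d₂ = suc (suc d)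
    M = motzkinWeight b l
    M′ = motzkinWeight (b ∘ suc) (l ∘ suc)
    Z = M 0
    regroup : ∀ l x b y m w → l * (x + b * y + m * w) ≈ l * x + b * (l * y) + m * (l * w)
    regroup = solve 6 (λ l x b y m w →
      l :* (x :+ b :* y :+ m :* w) := l :* x :+ b :* (l :* y) :+ m :* (l :* w)) refl

  jcoef-shift : ∀ b l f m k → jcoef R b l f (suc m) k ≈ jcoef R (b ∘ suc) (l ∘ suc) f m k
  jcoef-shift b l f       m zero          = refl
  jcoef-shift b l zero    m (suc k)       = refl
  jcoef-shift b l (suc f) m (suc zero)    = *-cong refl (jcoef-shift b l f m zero)
  jcoef-shift b l (suc f) m (suc (suc k)) =
    +-cong (*-cong refl (jcoef-shift b l f m (suc k)))
           (*-cong refl (⊛-cong k (λ i _ → jcoef-shift b l f (suc m) i) (λ j _ → jcoef-shift b l f m j)))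

  jcoef≈motzkinWeight : ∀ f b l k → k ≤ f → jcoef R b l f 0 k ≈ motzkinWeight b l 0 k
  jcoef≈motzkinWeight f       b l zero          _         = refl
  jcoef≈motzkinWeight zero    b l (suc k)       ()
  jcoef≈motzkinWeight (suc f) b l (suc zero)    _         = sym (+-identityˡ _)
  jcoef≈motzkinWeight (suc f) b l (suc (suc k)) (s≤s k<f) = begin
      b 0 * jcoef R b l f 0 (suc k) + l 1 * (jcoef R b l f 1 ⊛ jcoef R b l f 0) k
    ≈⟨ +-cong (*-cong refl (jcoef≈motzkinWeight f b l (suc k) k<f))
              (*-cong refl (⊛-cong k shifted (λ j j≤k → jcoef≈motzkinWeight f b l j (≤-trans j≤k k≤f)))) ⟩
      b 0 * motzkinWeight b l 0 (suc k) + l 1 * (motzkinWeight (b ∘ suc) (l ∘ suc) 0 ⊛ motzkinWeight b l 0) k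
    ≈⟨ trans (+-cong (motzkinWeight-descent b l k 0) refl) (+-comm _ _) ⟨
      motzkinWeight b l 0 (suc (suc k)) ∎
    where
    k≤f : k ≤ f
    k≤f = ≤-trans (n≤1+n k) k<f
    shifted : ∀ i → i ≤ k → jcoef R b l f 1 i ≈ motzkinWeight (b ∘ suc) (l ∘ suc) 0 i
    shifted i i≤k = trans (jcoef-shift b l f 0 i) (jcoef≈motzkinWeight f (b ∘ suc) (l ∘ suc) i (≤-trans i≤k k≤f))

  jfracCoef≈motzkinWeight : ∀ b l n → jfracCoef R b l n ≈ motzkinWeight b l 0 n
  jfracCoef≈motzkinWeight b l n = jcoef≈motzkinWeight n b l n ≤-refl

  sumOver : (List Step → Carrier) → List (List Step) → Carrier
  sumOver g ws = sumList R (map g ws)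

  sumOver-cong : ∀ {f g : List Step → Carrier} ws → (∀ w → f w ≈ g w) → sumOver f ws ≈ sumOver g ws
  sumOver-cong []       f≈g = refl
  sumOver-cong (w ∷ ws) f≈g = +-cong (f≈g w) (sumOver-cong ws f≈g)

  sumOver-* : ∀ a (f : List Step → Carrier) ws → sumOver (λ w → a * f w) ws ≈ a * sumOver f ws
  sumOver-* a f []       = sym (zeroʳ a)
  sumOver-* a f (w ∷ ws) = trans (+-cong refl (sumOver-* a f ws)) (sym (distribˡ _ _ _))

  sumOver-0# : ∀ ws → sumOver (λ _ → 0#) ws ≈ 0#
  sumOver-0# []       = refl
  sumOver-0# (w ∷ ws) = trans (+-identityˡ _) (sumOver-0# ws)

  sumOver-words-suc : ∀ (g : List Step → Carrier) n → sumOver g (words (suc n))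
    ≈ sumOver (g ∘ (U ∷_)) (words n) + (sumOver (g ∘ (L ∷_)) (words n) + sumOver (g ∘ (D ∷_)) (words n))
  sumOver-words-suc g n = go (words n)
    where
    go : ∀ ws → sumOver g (concatMap (λ w → (U ∷ w) ∷ (L ∷ w) ∷ (D ∷ w) ∷ []) ws)
      ≈ sumOver (g ∘ (U ∷_)) ws + (sumOver (g ∘ (L ∷_)) ws + sumOver (g ∘ (D ∷_)) ws)
    go []       = sym (trans (+-identityˡ _) (+-identityˡ _))
    go (w ∷ ws) = trans (+-cong refl (+-cong refl (+-cong refl (go ws)))) (interleave _ _ _ _ _ _)
      where
      interleave : ∀ a b c x y z → a + (b + (c + (x + (y + z)))) ≈ (a + x) + ((b + y) + (c + z))
      interleave = solve 6 (λ a b c x y z →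
        a :+ (b :+ (c :+ (x :+ (y :+ z)))) := (a :+ x) :+ ((b :+ y) :+ (c :+ z))) refl

  VanishesAtOddHeights : (ℕ → Carrier) → Set ℓ
  VanishesAtOddHeights b = ∀ h → isEven h ≡ false → b h ≈ 0#

  module _ (b l : ℕ → Carrier) where
    andreWeightFrom : ℕ → List Step → Carrier
    andreWeightFrom h w = if motzkinFrom h w ∧ noOddLevelFrom h w then weightFrom R b l h w else 0#

    andreSumFrom : ℕ → ℕ → Carrier
    andreSumFrom h n = sumOver (andreWeightFrom h) (words n)

    andreWeight-U : ∀ h w → andreWeightFrom h (U ∷ w) ≈ andreWeightFrom (suc h) w
    andreWeight-U h w with motzkinFrom (suc h) w ∧ noOddLevelFrom (suc h) w
    ... | true  = *-identityˡ _
    ... | false = refl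

    andreWeight-L : VanishesAtOddHeights b →
      ∀ h w → andreWeightFrom h (L ∷ w) ≈ b h * andreWeightFrom h w
    andreWeight-L b-odd h w with isEven h in eq | motzkinFrom h w | noOddLevelFrom h w
    ... | true  | true  | true  = refl
    ... | true  | true  | false = sym (zeroʳ _)
    ... | true  | false | _     = sym (zeroʳ _)
    ... | false | true  | _     = trans (sym (zeroˡ _)) (*-cong (sym (b-odd h eq)) refl)
    ... | false | false | _     = sym (zeroʳ _)

    andreWeight-D : ∀ h w → andreWeightFrom (suc h) (D ∷ w) ≈ l (suc h) * andreWeightFrom h w
    andreWeight-D h w with motzkinFrom h w ∧ noOddLevelFrom h w
    ... | true  = refl
    ... | false = sym (zeroʳ _)

    andreSum-L : VanishesAtOddHeights b →
      ∀ h n → sumOver (andreWeightFrom h ∘ (L ∷_)) (words n) ≈ b h * andreSumFrom h n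
    andreSum-L b-odd h n = trans (sumOver-cong (words n) (andreWeight-L b-odd h)) (sumOver-* (b h) _ (words n))

    andreSum-D : ∀ h n → sumOver (andreWeightFrom (suc h) ∘ (D ∷_)) (words n) ≈ l (suc h) * andreSumFrom h n
    andreSum-D h n = trans (sumOver-cong (words n) (andreWeight-D h)) (sumOver-* (l (suc h)) _ (words n))

    andreSumFrom≈motzkinWeight : VanishesAtOddHeights b →
      ∀ n h → andreSumFrom h n ≈ motzkinWeight b l h n
    andreSumFrom≈motzkinWeight b-odd zero    zero    = +-identityʳ _
    andreSumFrom≈motzkinWeight b-odd zero    (suc h) = +-identityʳ _
    andreSumFrom≈motzkinWeight b-odd (suc n) zero    = begin
        andreSumFrom 0 (suc n)
      ≈⟨ trans (sumOver-words-suc (andreWeightFrom 0) n)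
               (+-cong (sumOver-cong (words n) (andreWeight-U 0))
                       (+-cong (andreSum-L b-odd 0 n) (sumOver-0# (words n)))) ⟩
        andreSumFrom 1 n + (b 0 * andreSumFrom 0 n + 0#)
      ≈⟨ +-cong (IH 1) (trans (+-identityʳ _) (*-cong refl (IH 0))) ⟩
        motzkinWeight b l 0 (suc n) ∎
      where IH = andreSumFrom≈motzkinWeight b-odd n
    andreSumFrom≈motzkinWeight b-odd (suc n) (suc h) = begin
        andreSumFrom (suc h) (suc n)
      ≈⟨ trans (sumOver-words-suc (andreWeightFrom (suc h)) n)
               (+-cong (sumOver-cong (words n) (andreWeight-U (suc h)))
                       (+-cong (andreSum-L b-odd (suc h) n) (andreSum-D h n))) ⟩
        andreSumFrom (suc (suc h)) n + (b (suc h) * andreSumFrom (suc h) n + l (suc h) * andreSumFrom h n)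
      ≈⟨ sym (+-assoc _ _ _) ⟩
        andreSumFrom (suc (suc h)) n + b (suc h) * andreSumFrom (suc h) n + l (suc h) * andreSumFrom h n
      ≈⟨ +-cong (+-cong (IH (suc (suc h))) (*-cong refl (IH (suc h)))) (*-cong refl (IH h)) ⟩
        motzkinWeight b l (suc h) (suc n) ∎
      where IH = andreSumFrom≈motzkinWeight b-odd n

  bAndre-vanishesAtOddHeights : VanishesAtOddHeights (bAndre R)
  bAndre-vanishesAtOddHeights h isOdd rewrite isOdd = refl

  pqInt-1-suc : ∀ q m → pqInt R 1# q (suc (suc m)) ≈ pow R q (suc m) + pqInt R 1# q (suc m)
  pqInt-1-suc q m = trans (sum-suc m _)
    (+-cong (*-identityˡ _) (sum-cong m (λ i _ → *-cong (*-identityˡ _) refl)))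

  pqInt-1-neg1 : ∀ m → pqInt R 1# (- 1#) (suc m) ≈ bAndre R m
  pqInt-1-neg1 zero          = *-identityˡ 1#
  pqInt-1-neg1 (suc zero)    =
    trans (pqInt-1-suc (- 1#) 0) (trans (+-cong (*-identityʳ _) (*-identityˡ 1#)) (-‿inverseˡ 1#))
  pqInt-1-neg1 (suc (suc m)) = begin
      pqInt R 1# (- 1#) (suc (suc (suc m)))
    ≈⟨ trans (pqInt-1-suc (- 1#) (suc m)) (+-cong refl (pqInt-1-suc (- 1#) m)) ⟩
      - 1# * pow R (- 1#) (suc m) + (pow R (- 1#) (suc m) + pqInt R 1# (- 1#) (suc m))
    ≈⟨ sym (+-assoc _ _ _) ⟩
      - 1# * pow R (- 1#) (suc m) + pow R (- 1#) (suc m) + pqInt R 1# (- 1#) (suc m)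
    ≈⟨ +-cong (trans (+-cong (-1*x≈-x _) refl) (-‿inverseˡ _)) (pqInt-1-neg1 m) ⟩
      0# + bAndre R m
    ≈⟨ +-identityˡ _ ⟩
      bAndre R m ∎

  pow-1# : ∀ i → pow R 1# i ≈ 1#
  pow-1# zero    = refl
  pow-1# (suc i) = trans (*-identityˡ _) (pow-1# i)

  pqBinom-1-neg1-suc-1 : ∀ n → pqBinom R 1# (- 1#) (suc n) 1 ≈ 1# + - pqBinom R 1# (- 1#) n 1
  pqBinom-1-neg1-suc-1 n =
    +-cong (trans (*-identityʳ _) (pow-1# n)) (trans (*-cong (*-identityʳ _) refl) (-1*x≈-x _))

  pqBinom-1-neg1-suc-2 : ∀ n →
    pqBinom R 1# (- 1#) (suc n) 2 ≈ pqBinom R 1# (- 1#) n 1 + pqBinom R 1# (- 1#) n 2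
  pqBinom-1-neg1-suc-2 n = +-cong (trans (*-cong (pow-1# (n ∸ 1)) refl) (*-identityˡ _))
                                  (trans (*-cong neg1² refl) (*-identityˡ _))
    where
    neg1² : - 1# * (- 1# * 1#) ≈ 1#
    neg1² = trans (*-cong refl (*-identityʳ _)) (trans (-1*x≈-x _) (-‿involutive 1#))

  pqBinom-1-neg1-2 : ∀ t n → pqBinom R 1# (- 1#) n 2 * t ≈ natTimes R (n / 2) t
  pqBinom-1-neg1-2 t zero          = zeroˡ t
  pqBinom-1-neg1-2 t (suc zero)    =
    trans (*-cong (trans (+-cong (zeroʳ _) (zeroʳ _)) (+-identityʳ 0#)) refl) (zeroˡ t)
  pqBinom-1-neg1-2 t (suc (suc n)) = begin
      β₂ (suc (suc n)) * t
    ≈⟨ *-cong (trans (pqBinom-1-neg1-suc-2 (suc n))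
                     (+-cong (pqBinom-1-neg1-suc-1 n) (pqBinom-1-neg1-suc-2 n))) refl ⟩
      ((1# + - β₁ n) + (β₁ n + β₂ n)) * t
    ≈⟨ *-cong (cancel 1# (β₁ n) (β₂ n)) refl ⟩
      (1# + β₂ n) * t
    ≈⟨ trans (distribʳ _ _ _) (+-cong (*-identityˡ t) (pqBinom-1-neg1-2 t n)) ⟩
      t + natTimes R (n / 2) t
    ≈⟨ reflexive (≡.cong (λ k → natTimes R k t) (≡.sym halve)) ⟩
      natTimes R (suc (suc n) / 2) t ∎
    where
    β₁ β₂ : ℕ → Carrier
    β₁ k = pqBinom R 1# (- 1#) k 1
    β₂ k = pqBinom R 1# (- 1#) k 2
    halve : suc (suc n) / 2 ≡ suc (n / 2)
    halve = m/n≡1+[m∸n]/n {suc (suc n)} {2} (s≤s (s≤s z≤n))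
    cancel : ∀ a x y → (a + - x) + (x + y) ≈ a + y
    cancel a x y = begin
      (a + - x) + (x + y) ≈⟨ +-assoc a (- x) (x + y) ⟩
      a + (- x + (x + y)) ≈⟨ +-cong refl (+-assoc (- x) x y) ⟨
      a + ((- x + x) + y) ≈⟨ +-cong refl (trans (+-cong (-‿inverseˡ x) refl) (+-identityˡ y)) ⟩
      a + y               ∎

lemma3p4 : ∀ {c ℓ} (R : CommutativeRing c ℓ) (t : CommutativeRing.Carrier R) (n : ℕ) →
    CommutativeRing._≈_ R
      (Dpoly R (CommutativeRing.1# R) (CommutativeRing.-_ R (CommutativeRing.1# R)) t (suc n))
      (andreSum R (bAndre R) (lamAndre R t) n)
lemma3p4 R t n = begin
    Dpoly R 1# (- 1#) t (suc n)
  ≈⟨ jfracCoef≈motzkinWeight R b λ′ n ⟩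
    motzkinWeight R b λ′ 0 n
  ≈⟨ motzkinWeight-cong R (pqInt-1-neg1 R) (λ m → pqBinom-1-neg1-2 R t (suc m)) 0 n ⟩
    motzkinWeight R (bAndre R) (lamAndre R t) 0 n
  ≈⟨ andreSumFrom≈motzkinWeight R (bAndre R) (lamAndre R t) (bAndre-vanishesAtOddHeights R) n 0 ⟨
    andreSum R (bAndre R) (lamAndre R t) n ∎
  where
  open CommutativeRing R
  open SetoidReasoning setoid
  b λ′ : ℕ → Carrier
  b m  = pqInt R 1# (- 1#) (suc m)
  λ′ m = pqBinom R 1# (- 1#) (suc m) 2 * t
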